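{- Let $k,\ell$ be odd integers with $\gcd(k,\ell)=1$ and $k<\ell<\sqrt3 k$. Then there exist positive integers $d_1,d_2$ such that $d=d_1d_2$ is squarefree, $d\equiv 3\pmod 4$, $d_1<d_2\le 3d_1$ and $k^2d_2-\ell^2d_1=\pm 2$. Moreover, if $(d_1',d_2',k,\ell)$ is any tuple of integers with $d_1',d_2'>0$, $d_1'd_2'$ squarefree, $d_1'd_2'\equiv 3\pmod 4$, $d_1'<d_2'\le 3d_1'$ and $k^2d_2'-\ell^2d_1'=\pm2$, then for infinitely many integers $n$ the tuple $(d_1'+2k^2n,\ d_2'+2\ell^2n,\ k,\ \ell)$ satisfies the same conditions, i.e. $d_1''=d_1'+2k^2n$, $d_2''=d_2'+2\ell^2n$ are positive, $d_1''d_2''$ is squarefree and $\equiv 3\pmod 4$, $d_1''<d_2''\le 3d_1''$, and $k^2d_2''-\ell^2d_1''=\pm2$. -}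

module Defs where

open import Data.Nat using (ℕ)
open import Data.Integer using (ℤ; +_; -_; _+_; _-_; _*_; _<_; _≤_; ∣_∣)
open import Data.Integer.Divisibility using (_∣_)
open import Data.Product using (_×_; ∃)
open import Data.Sum using (_⊎_)
open import Relation.Nullary using (¬_)
open import Relation.Binary.PropositionalEquality using (_≡_)

Odd : ℤ → Set
Odd n = ¬ ((+ 2) ∣ n)

Squarefree : ℤ → Set
Squarefree n = ∀ (m : ℤ) → (m * m) ∣ n → ∣ m ∣ ≡ 1

≡3mod4 : ℤ → Set
≡3mod4 n = (+ 4) ∣ (n - + 3)

-- l < √3 · k, stated exactly over the integers (no reals needed):
--  if k ≥ 0 then √3 k ≥ 0 and l < √3 k iff l < 0 or l² < 3k²;
--  if k < 0 then √3 k < 0 and l < √3 k iff l < 0 and l² > 3k².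
LtSqrt3Times : ℤ → ℤ → Set
LtSqrt3Times l k =
  ((+ 0 ≤ k) × (l < + 0 ⊎ l * l < + 3 * (k * k)))
  ⊎ ((k < + 0) × (l < + 0) × (+ 3 * (k * k) < l * l))

Good : ℤ → ℤ → ℤ → ℤ → Set
Good d₁ d₂ k l =
  (+ 0 < d₁) × (+ 0 < d₂)
  × Squarefree (d₁ * d₂)
  × ≡3mod4 (d₁ * d₂)
  × (d₁ < d₂) × (d₂ ≤ + 3 * d₁)
  × ((k * k * d₂ - l * l * d₁ ≡ + 2) ⊎ (k * k * d₂ - l * l * d₁ ≡ - (+ 2)))

module Submission where

-- Shifting d₁ ↦ d₁ + 2k²n, d₂ ↦ d₂ + 2l²n keeps k²d₂ − l²d₁ fixed, keeps d₁, d₂ odd (which together with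
-- k²d₂ − l²d₁ = ±2 forces d₁d₂ ≡ 3 mod 4) and, as k² < l² < 3k², keeps d₁ < d₂ ≤ 3d₁. A first pair with all
-- properties but squarefreeness comes from a Bézout identity for the coprime squares k², l². Squarefreeness of some shift is a sieve: the
-- factors x(n) = d₁ + 2k²n and y(n) = d₂ + 2l²n are odd and l²x(n), k²y(n) differ by 2, so a prime square
-- dividing x(n)y(n) divides one factor, and for an odd prime p the n with p² ∣ x(n) are at least p² apart.
-- In a window of length L this excludes at most 2 Σₚ (1 + L/p²) < L values of n, the sum running over the
-- odd p up to the square root of the largest value on the window.

module WindowCounting where

  open import Data.Nat
  open import Data.Nat.Properties
  open import Data.Nat.DivMod using (_/_; m≡m%n+[m/n]*n; m%n≤n; m*n/n≡m; m/n*n≤m; /-monoˡ-≤)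
  open import Data.Product using (∃; _×_; _,_)
  open import Data.Sum using (_⊎_; [_,_]′; inj₁; inj₂)
  open import Level using (0ℓ)
  open import Relation.Nullary using (¬_; yes; no; contradiction)
  open import Relation.Unary using (Pred; Decidable; _⊆_; _∪_)
  open import Relation.Binary.PropositionalEquality
  open import Algebra.Properties.CommutativeSemigroup +-commutativeSemigroup using (xy∙z≈y∙xz; x∙yz≈y∙xz)

  module _ {P : Pred ℕ 0ℓ} (P? : Decidable P) where

    count : ℕ → ℕ → ℕ
    count s zero = 0
    count s (suc L) with P? s
    ... | yes _ = suc (count (suc s) L)
    ... | no _  = count (suc s) L

    count-++ : ∀ s L M → count s (L + M) ≡ count s L + count (s + L) M
    count-++ s zero M = cong (λ t → count t M) (sym (+-identityʳ s))
    count-++ s (suc L) M rewrite +-suc s L with P? s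
    ... | yes _ = cong suc (count-++ (suc s) L M)
    ... | no _  = count-++ (suc s) L M

    count-none : ∀ s L → (∀ n → s ≤ n → n < s + L → ¬ P n) → count s L ≡ 0
    count-none s zero _ = refl
    count-none s (suc L) ¬P with P? s
    ... | yes p = contradiction p (¬P s ≤-refl (m<m+n s z<s))
    ... | no _  = count-none (suc s) L λ n s<n n<s+L → ¬P n (<⇒≤ s<n) (subst (n <_) (sym (+-suc s L)) n<s+L)

    count<⇒∃¬ : ∀ s L → count s L < L → ∃ λ n → s ≤ n × n < s + L × ¬ P n
    count<⇒∃¬ s (suc L) c<L with P? s
    ... | no ¬p = s , ≤-refl , m<m+n s z<s , ¬p
    ... | yes _ with count<⇒∃¬ (suc s) L (s<s⁻¹ c<L)
    ...   | n , s<n , n<s+L , ¬p = n , <⇒≤ s<n , subst (n <_) (sym (+-suc s L)) n<s+L , ¬p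

  Sparse : ℕ → Pred ℕ 0ℓ → Set
  Sparse q P = ∀ {m n} → m < n → P m → P n → m + q ≤ n

  module _ {P : Pred ℕ 0ℓ} (P? : Decidable P) {q : ℕ} (sparse : Sparse q P) where

    count-block : ∀ s L → L ≤ q → count P? s L ≤ 1
    count-block s zero _ = z≤n
    count-block s (suc L) L<q with P? s
    ... | yes p = ≤-reflexive (cong suc (count-none P? (suc s) L gap))
      where
      gap : ∀ n → suc s ≤ n → n < suc s + L → ¬ P n
      gap n s<n n≤s+L pn = <⇒≱ n≤s+L (begin
        suc s + L  ≡⟨ +-suc s L ⟨
        s + suc L  ≤⟨ +-monoʳ-≤ s L<q ⟩
        s + q      ≤⟨ sparse s<n p pn ⟩
        n          ∎)
        where open ≤-Reasoning
    ... | no _ = count-block (suc s) L (<⇒≤ L<q)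

    count-sparse : .{{_ : NonZero q}} → ∀ s L → count P? s L ≤ suc (L / q)
    count-sparse s L =
      blocks (L / q) s L (≤-trans (≤-reflexive (m≡m%n+[m/n]*n L q)) (+-monoˡ-≤ _ (m%n≤n L q)))
      where
      blocks : ∀ t s L → L ≤ suc t * q → count P? s L ≤ suc t
      blocks t s L L≤ with L ≤? q
      ... | yes L≤q = ≤-trans (count-block s L L≤q) (s≤s z≤n)
      blocks zero s L L≤ | no L≰q = contradiction (≤-trans L≤ (≤-reflexive (+-identityʳ q))) L≰q
      blocks (suc t) s L L≤ | no L≰q = begin
        count P? s L                              ≡⟨ cong (count P? s) (m+[n∸m]≡n q≤L) ⟨
        count P? s (q + (L ∸ q))                  ≡⟨ count-++ P? s q (L ∸ q) ⟩
        count P? s q + count P? (s + q) (L ∸ q)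
          ≤⟨ +-mono-≤ (count-block s q ≤-refl) (blocks t (s + q) (L ∸ q) rest) ⟩
        suc (suc t)                               ∎
        where
        open ≤-Reasoning
        q≤L : q ≤ L
        q≤L = <⇒≤ (≰⇒> L≰q)
        rest : L ∸ q ≤ suc t * q
        rest = ≤-trans (∸-monoˡ-≤ q L≤) (≤-reflexive (m+n∸m≡n q (suc t * q)))

  count-⊆∪ : ∀ {P Q R : Pred ℕ 0ℓ} (P? : Decidable P) (Q? : Decidable Q) (R? : Decidable R) →
             P ⊆ Q ∪ R → ∀ s L → count P? s L ≤ count Q? s L + count R? s L
  count-⊆∪ P? Q? R? P⊆Q∪R s zero = z≤n
  count-⊆∪ P? Q? R? P⊆Q∪R s (suc L) with P? s | Q? s | R? s | count-⊆∪ P? Q? R? P⊆Q∪R (suc s) L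
  ... | yes _ | yes _ | yes _ | ih = s≤s (≤-trans ih (+-monoʳ-≤ (count Q? (suc s) L) (n≤1+n _)))
  ... | yes _ | yes _ | no _  | ih = s≤s ih
  ... | yes _ | no _  | yes _ | ih = ≤-trans (s≤s ih) (≤-reflexive (sym (+-suc (count Q? (suc s) L) _)))
  ... | yes p | no ¬q | no ¬r | _  = contradiction (P⊆Q∪R p) [ ¬q , ¬r ]′
  ... | no _  | yes _ | yes _ | ih = ≤-trans ih (+-mono-≤ (n≤1+n _) (n≤1+n _))
  ... | no _  | yes _ | no _  | ih = ≤-trans ih (+-monoˡ-≤ (count R? (suc s) L) (n≤1+n _))
  ... | no _  | no _  | yes _ | ih = ≤-trans ih (+-monoʳ-≤ (count Q? (suc s) L) (n≤1+n _))
  ... | no _  | no _  | no _  | ih = ih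

  module _ {Q : ℕ → Pred ℕ 0ℓ} (Q? : ∀ j → Decidable (Q j)) where

    Any? : ∀ J → Decidable (λ n → ∃ λ j → j < J × Q j n)
    Any? J n = anyUpTo? (λ j → Q? j n) J

    -- The union bound, with the bounds c + g j ∸ g (suc j) on the single counts telescoping.
    count-Any : ∀ s L (c : ℕ) (g : ℕ → ℕ) → (∀ j → count (Q? j) s L + g (suc j) ≤ c + g j) →
                    ∀ J → count (Any? J) s L + g J ≤ J * c + g 0
    count-Any s L c g step zero =
      ≤-reflexive (cong (_+ g 0) (count-none (Any? 0) s L λ { _ _ _ (_ , () , _) }))
    count-Any s L c g step (suc J) = begin
      count (Any? (suc J)) s L + g (suc J)
        ≤⟨ +-monoˡ-≤ _ (count-⊆∪ (Any? (suc J)) (Q? J) (Any? J) split s L) ⟩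
      count (Q? J) s L + count (Any? J) s L + g (suc J)
        ≡⟨ xy∙z≈y∙xz (count (Q? J) s L) (count (Any? J) s L) (g (suc J)) ⟩
      count (Any? J) s L + (count (Q? J) s L + g (suc J))
        ≤⟨ +-monoʳ-≤ (count (Any? J) s L) (step J) ⟩
      count (Any? J) s L + (c + g J)
        ≡⟨ x∙yz≈y∙xz (count (Any? J) s L) c (g J) ⟩
      c + (count (Any? J) s L + g J)
        ≤⟨ +-monoʳ-≤ c (count-Any s L c g step J) ⟩
      c + (J * c + g 0)
        ≡⟨ +-assoc c _ _ ⟨
      suc J * c + g 0 ∎
      where
      open ≤-Reasoning
      split : ∀ {n} → (∃ λ j → j < suc J × Q j n) → Q J n ⊎ (∃ λ j → j < J × Q j n)
      split (j , j<1+J , q) with m<1+n⇒m<n∨m≡n j<1+J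
      ... | inj₁ j<J  = inj₂ (j , j<J , q)
      ... | inj₂ refl = inj₁ q

  /-telescope : ∀ m n → m / (suc n * suc (suc n)) + m / suc (suc n) ≤ m / suc n
  /-telescope m n = begin
    q₁ + q₂                      ≡⟨ m*n/n≡m (q₁ + q₂) (suc n) ⟨
    (q₁ + q₂) * suc n / suc n    ≤⟨ /-monoˡ-≤ (suc n) bound ⟩
    m / suc n                    ∎
    where
    open ≤-Reasoning
    q₁ q₂ : ℕ
    q₁ = m / (suc n * suc (suc n))
    q₂ = m / suc (suc n)
    q₁[n+1]≤q₂ : q₁ * suc n ≤ q₂
    q₁[n+1]≤q₂ = begin
      q₁ * suc n                               ≡⟨ m*n/n≡m (q₁ * suc n) (suc (suc n)) ⟨
      q₁ * suc n * suc (suc n) / suc (suc n)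
        ≤⟨ /-monoˡ-≤ (suc (suc n)) (≤-trans (≤-reflexive (*-assoc q₁ (suc n) _)) (m/n*n≤m m _)) ⟩
      q₂                                       ∎
    bound : (q₁ + q₂) * suc n ≤ m
    bound = begin
      (q₁ + q₂) * suc n         ≡⟨ *-distribʳ-+ (suc n) q₁ q₂ ⟩
      q₁ * suc n + q₂ * suc n   ≤⟨ +-monoˡ-≤ _ q₁[n+1]≤q₂ ⟩
      q₂ + q₂ * suc n           ≡⟨ *-suc q₂ (suc n) ⟨
      q₂ * suc (suc n)          ≤⟨ m/n*n≤m m (suc (suc n)) ⟩
      m                         ∎

module SquareDivisors where

  open import Data.Nat
  open import Data.Nat.Properties
  open import Data.Nat.Divisibility
  open import Data.Nat.Primality
  open import Data.Nat.Primality.Factorisation using (factorise)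
  open import Data.Nat.Coprimality as Coprime using (Coprime; coprime-divisor)
  open import Data.Nat.ListAction using (product)
  open import Data.List using ([]; _∷_)
  open import Data.List.Relation.Unary.All using (_∷_)
  open import Data.Product using (∃; _×_; _,_)
  open import Data.Sum using (_⊎_; inj₁; inj₂)
  open import Relation.Nullary using (¬_; yes; no; contradiction)
  open import Relation.Binary.PropositionalEquality
  open import Data.Nat.Tactic.RingSolver using (solve-∀)
  open WindowCounting using (Sparse)

  Squarefreeℕ : ℕ → Set
  Squarefreeℕ n = ∀ m → m * m ∣ n → m ≡ 1

  ∤m∣n⇒∤m+n : ∀ {d m n} → ¬ d ∣ m → d ∣ n → ¬ d ∣ m + n
  ∤m∣n⇒∤m+n {d} {m} {n} d∤m d∣n d∣m+n = d∤m (∣m+n∣m⇒∣n (subst (d ∣_) (+-comm m n) d∣m+n) d∣n)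

  odd⇒≡1+2* : ∀ {m} → ¬ 2 ∣ m → ∃ λ w → m ≡ 1 + 2 * w
  odd⇒≡1+2* {0} 2∤0 = contradiction (2 ∣0) 2∤0
  odd⇒≡1+2* {1} _ = 0 , refl
  odd⇒≡1+2* {suc (suc m)} 2∤m+2 with odd⇒≡1+2* {m} (λ 2∣m → 2∤m+2 (∣m∣n⇒∣m+n (∣-refl {2}) 2∣m))
  ... | w , refl = suc w , cong suc (sym (*-suc 2 w))

  odd⇒nonZero : ∀ {m} → ¬ 2 ∣ m → NonZero m
  odd⇒nonZero {0} 2∤0 = contradiction (2 ∣0) 2∤0
  odd⇒nonZero {suc m} _ = _

  odd*odd : ∀ {m n} → ¬ 2 ∣ m → ¬ 2 ∣ n → ¬ 2 ∣ m * n
  odd*odd {m} {n} 2∤m 2∤n 2∣mn with euclidsLemma m n prime[2] 2∣mn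
  ... | inj₁ 2∣m = 2∤m 2∣m
  ... | inj₂ 2∣n = 2∤n 2∣n

  prime⇒≥2 : ∀ {p} → Prime p → 2 ≤ p
  prime⇒≥2 {p} p-prime = nonTrivial⇒n>1 p {{prime⇒nonTrivial p-prime}}

  prime∣2⇒≡2 : ∀ {p} → Prime p → p ∣ 2 → p ≡ 2
  prime∣2⇒≡2 p-prime p∣2 = ≤-antisym (∣⇒≤ p∣2) (prime⇒≥2 p-prime)

  odd-prime⇒≡3+2* : ∀ {p} → Prime p → ¬ 2 ∣ p → ∃ λ j → p ≡ 3 + 2 * j
  odd-prime⇒≡3+2* p-prime 2∤p with odd⇒≡1+2* 2∤p | prime⇒≥2 p-prime
  ... | zero , refl  | s≤s ()
  ... | suc j , refl | _ = j , cong suc (*-suc 2 j)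

  prime-divisor : ∀ {m} → 2 ≤ m → ∃ λ p → Prime p × p ∣ m
  prime-divisor {1} (s≤s ())
  prime-divisor {suc (suc m)} _ with factorise (2 + m)
  ... | record { factors = [] ; isFactorisation = () }
  ... | record { factors = p ∷ ps ; isFactorisation = eq ; factorsPrime = p-prime ∷ _ } =
    p , p-prime , divides (product ps) (trans eq (*-comm p (product ps)))

  squarefree-by-primes : ∀ {n} .{{_ : NonZero n}} → (∀ {p} → Prime p → ¬ p * p ∣ n) → Squarefreeℕ n
  squarefree-by-primes {n} _ 0 0∣n = contradiction (0∣⇒≡0 0∣n) (≢-nonZero⁻¹ n)
  squarefree-by-primes _ 1 _ = refl
  squarefree-by-primes no-square (suc (suc m)) m²∣n with prime-divisor {2 + m} (s≤s (s≤s z≤n))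
  ... | p , p-prime , p∣m = contradiction (∣-trans (*-pres-∣ p∣m p∣m) m²∣n) (no-square p-prime)

  prime²∣*-cancel : ∀ {p} m n → Prime p → ¬ p ∣ n → p * p ∣ m * n → p * p ∣ m
  prime²∣*-cancel {p} m n p-prime p∤n p²∣mn with euclidsLemma m n p-prime (m*n∣⇒m∣ p p p²∣mn)
  ... | inj₂ p∣n = contradiction p∣n p∤n
  ... | inj₁ (divides q refl) = *-monoˡ-∣ p p∣q
    where
    instance
      p≢0 : NonZero p
      p≢0 = prime⇒nonZero p-prime
    rearrange : ∀ q p n → q * p * n ≡ p * (q * n)
    rearrange = solve-∀
    p∣qn : p ∣ q * n
    p∣qn = *-cancelˡ-∣ p (subst (p * p ∣_) (rearrange q p n) p²∣mn)
    p∣q : p ∣ q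
    p∣q with euclidsLemma q n p-prime p∣qn
    ... | inj₁ p∣q = p∣q
    ... | inj₂ p∣n = contradiction p∣n p∤n

  prime²∣*-split : ∀ {p} m n → Prime p → ¬ (p ∣ m × p ∣ n) → p * p ∣ m * n → p * p ∣ m ⊎ p * p ∣ n
  prime²∣*-split {p} m n p-prime coprime p²∣mn with euclidsLemma m n p-prime (m*n∣⇒m∣ p p p²∣mn)
  ... | inj₁ p∣m = inj₁ (prime²∣*-cancel m n p-prime (λ p∣n → coprime (p∣m , p∣n)) p²∣mn)
  ... | inj₂ p∣n = inj₂ (prime²∣*-cancel n m p-prime (λ p∣m → coprime (p∣m , p∣n))
                           (subst (p * p ∣_) (*-comm m n) p²∣mn))

  square-divisors-sparse : ∀ {p} a c → Prime p → ¬ (p ∣ a × p ∣ c) → Sparse (p * p) (λ n → p * p ∣ a + c * n)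
  square-divisors-sparse {p} a c p-prime coprime {m} {n} m<n p²∣x[m] p²∣x[n] = begin
    m + p * p     ≤⟨ +-monoʳ-≤ m (∣⇒≤ {{>-nonZero (m<n⇒0<n∸m m<n)}} p²∣n-m) ⟩
    m + (n ∸ m)   ≡⟨ m+[n∸m]≡n (<⇒≤ m<n) ⟩
    n             ∎
    where
    open ≤-Reasoning
    expand : ∀ a c m d → a + c * (m + d) ≡ (a + c * m) + c * d
    expand = solve-∀
    x[n]≡x[m]+c[n-m] : a + c * n ≡ (a + c * m) + c * (n ∸ m)
    x[n]≡x[m]+c[n-m] = trans (cong (λ t → a + c * t) (sym (m+[n∸m]≡n (<⇒≤ m<n)))) (expand a c m (n ∸ m))
    p∤c : ¬ p ∣ c
    p∤c p∣c =
      coprime (∣m+n∣m⇒∣n (subst (p ∣_) (+-comm a (c * m)) (m*n∣⇒m∣ p p p²∣x[m])) (∣m⇒∣m*n m p∣c) , p∣c)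
    p²∣c[n-m] : p * p ∣ c * (n ∸ m)
    p²∣c[n-m] = ∣m+n∣m⇒∣n (subst (p * p ∣_) x[n]≡x[m]+c[n-m] p²∣x[n]) p²∣x[m]
    p²∣n-m : p * p ∣ n ∸ m
    p²∣n-m = prime²∣*-cancel (n ∸ m) c p-prime p∤c (subst (p * p ∣_) (*-comm c (n ∸ m)) p²∣c[n-m])

  square-cancel-≤ : ∀ {m n} → m * m ≤ n * n → m ≤ n
  square-cancel-≤ {m} {n} m²≤n² with m ≤? n
  ... | yes m≤n = m≤n
  ... | no m≰n  = contradiction m²≤n² (<⇒≱ (*-mono-< (≰⇒> m≰n) (≰⇒> m≰n)))

  coprime-squares : ∀ {m n} → Coprime m n → Coprime (m * m) (n * n)
  coprime-squares c = Coprime.sym (coprime-square (Coprime.sym (coprime-square c)))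
    where
    coprime-square : ∀ {m n} → Coprime m n → Coprime m (n * n)
    coprime-square c (d∣m , d∣n²) = c (d∣m , coprime-divisor (λ (e∣d , e∣n) → c (∣-trans e∣d d∣m , e∣n)) d∣n²)

module SquarefreeValues where

  open import Data.Nat
  open import Data.Nat.Properties
  open import Data.Nat.Divisibility
  open import Data.Nat.DivMod using (_/_; m*n/n≡m; /-monoʳ-≤; m/n/o≡m/[n*o]; n/n≡1; n/1≡n)
  open import Data.Nat.Primality using (Prime; prime?; euclidsLemma)
  open import Data.Product using (∃; _×_; _,_)
  open import Data.Sum using (_⊎_; inj₁; inj₂; [_,_]′)
  import Data.Sum as Sum
  open import Level using (0ℓ)
  open import Relation.Nullary using (¬_)
  open import Relation.Nullary.Decidable using (_×-dec_)
  open import Relation.Unary using (Pred; Decidable; _∪_)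
  open import Relation.Unary.Properties using (_∪?_)
  open import Relation.Binary.PropositionalEquality hiding (J)
  open import Data.Nat.Tactic.RingSolver using (solve-∀)
  open WindowCounting
  open SquareDivisors

  relation-shift : ∀ A B c e n → e * A + 2 ≡ c * B → e * (A + 2 * c * n) + 2 ≡ c * (B + 2 * e * n)
  relation-shift A B c e n eA+2≡cB = begin
    e * (A + 2 * c * n) + 2       ≡⟨ expand₁ e A c n ⟩
    (e * A + 2) + 2 * c * e * n   ≡⟨ cong (_+ 2 * c * e * n) eA+2≡cB ⟩
    c * B + 2 * c * e * n         ≡⟨ expand₂ c B e n ⟨
    c * (B + 2 * e * n)           ∎
    where
    open ≡-Reasoning
    expand₁ : ∀ e A c n → e * (A + 2 * c * n) + 2 ≡ (e * A + 2) + 2 * c * e * n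
    expand₁ = solve-∀
    expand₂ : ∀ c B e n → c * (B + 2 * e * n) ≡ c * B + 2 * c * e * n
    expand₂ = solve-∀

  ∣-differ-by-2 : ∀ {d m n} → m + 2 ≡ n ⊎ n + 2 ≡ m → d ∣ m → d ∣ n → d ∣ 2
  ∣-differ-by-2 (inj₁ refl) d∣m d∣n = ∣m+n∣m⇒∣n d∣n d∣m
  ∣-differ-by-2 (inj₂ refl) d∣m d∣n = ∣m+n∣m⇒∣n d∣m d∣n

  module _ (A B c e : ℕ) (A-odd : ¬ 2 ∣ A) (B-odd : ¬ 2 ∣ B)
           (relation : e * A + 2 ≡ c * B ⊎ c * B + 2 ≡ e * A) where

    x y : ℕ → ℕ
    x n = A + 2 * c * n
    y n = B + 2 * e * n

    x-odd : ∀ n → ¬ 2 ∣ x n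
    x-odd n = ∤m∣n⇒∤m+n A-odd (∣m⇒∣m*n n (m∣m*n c))

    y-odd : ∀ n → ¬ 2 ∣ y n
    y-odd n = ∤m∣n⇒∤m+n B-odd (∣m⇒∣m*n n (m∣m*n e))

    relation-at : ∀ n → e * x n + 2 ≡ c * y n ⊎ c * y n + 2 ≡ e * x n
    relation-at n = Sum.map (relation-shift A B c e n) (relation-shift B A e c n) relation

    no-common-prime : ∀ {p} n → Prime p → ¬ (p ∣ x n × p ∣ y n)
    no-common-prime {p} n p-prime (p∣x , p∣y) = x-odd n (subst (_∣ x n) (prime∣2⇒≡2 p-prime p∣2) p∣x)
      where
      p∣2 : p ∣ 2
      p∣2 = ∣-differ-by-2 (relation-at n) (∣n⇒∣m*n e p∣x) (∣n⇒∣m*n c p∣y)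

    x-coefficients-coprime : ∀ {p} → Prime p → ¬ (p ∣ A × p ∣ 2 * c)
    x-coefficients-coprime {p} p-prime (p∣A , p∣2c) = A-odd (subst (_∣ A) (prime∣2⇒≡2 p-prime p∣2) p∣A)
      where
      p∣2 : p ∣ 2
      p∣2 = [ (λ p∣2 → p∣2) , (λ p∣c → ∣-differ-by-2 relation (∣n⇒∣m*n e p∣A) (∣m⇒∣m*n B p∣c)) ]′
              (euclidsLemma 2 c p-prime p∣2c)

    y-coefficients-coprime : ∀ {p} → Prime p → ¬ (p ∣ B × p ∣ 2 * e)
    y-coefficients-coprime {p} p-prime (p∣B , p∣2e) = B-odd (subst (_∣ B) (prime∣2⇒≡2 p-prime p∣2) p∣B)
      where
      p∣2 : p ∣ 2
      p∣2 = [ (λ p∣2 → p∣2) , (λ p∣e → ∣-differ-by-2 relation (∣m⇒∣m*n A p∣e) (∣n⇒∣m*n c p∣B)) ]′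
              (euclidsLemma 2 e p-prime p∣2e)

    -- On the window [N, N + L) both x and y stay below J², so an odd prime whose square divides one of their
    -- values is p j = 3 + 2j for some j < J. Since p j² > 4(j + 1)(j + 2), the counts 2 + 2 ⌊L / p j²⌋
    -- of such values telescope to less than 2J + 2X ≤ L = 4X.
    module Window (N : ℕ) where

      K R J X L : ℕ
      K = 2 * c + 2 * e
      R = suc (A + B + K * (N + 4))
      J = R + 4 * K
      X = suc J
      L = X * 4

      p : ℕ → ℕ
      p j = 3 + 2 * j

      HitX HitY Hit : ℕ → Pred ℕ 0ℓ
      HitX j n = Prime (p j) × p j * p j ∣ x n
      HitY j n = Prime (p j) × p j * p j ∣ y n
      Hit j = HitX j ∪ HitY j

      HitX? : ∀ j → Decidable (HitX j)
      HitX? j n = prime? (p j) ×-dec (p j * p j ∣? x n)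

      HitY? : ∀ j → Decidable (HitY j)
      HitY? j n = prime? (p j) ×-dec (p j * p j ∣? y n)

      Hit? : ∀ j → Decidable (Hit j)
      Hit? j = HitX? j ∪? HitY? j

      tail : ℕ → ℕ
      tail j = 2 * (X / suc j)

      4[j+1][j+2]≤p² : ∀ j → 4 * (suc j * suc (suc j)) ≤ p j * p j
      4[j+1][j+2]≤p² j = ≤-trans (n≤1+n _) (≤-reflexive (sym (square j)))
        where
        square : ∀ j → (3 + 2 * j) * (3 + 2 * j) ≡ 1 + 4 * (suc j * suc (suc j))
        square = solve-∀

      L/p²≤X/[j+1][j+2] : ∀ j → L / (p j * p j) ≤ X / (suc j * suc (suc j))
      L/p²≤X/[j+1][j+2] j = begin
        L / (p j * p j)                   ≤⟨ /-monoʳ-≤ L (4[j+1][j+2]≤p² j) ⟩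
        L / (4 * (suc j * suc (suc j)))   ≡⟨ m/n/o≡m/[n*o] L 4 _ ⟨
        L / 4 / (suc j * suc (suc j))     ≡⟨ cong (_/ (suc j * suc (suc j))) (m*n/n≡m X 4) ⟩
        X / (suc j * suc (suc j))         ∎
        where open ≤-Reasoning

      count-Hit : ∀ j → count (Hit? j) N L + tail (suc j) ≤ 2 + tail j
      count-Hit j = begin
        count (Hit? j) N L + tail (suc j)
          ≤⟨ +-monoˡ-≤ (tail (suc j)) (count-⊆∪ (Hit? j) (HitX? j) (HitY? j) (λ hit → hit) N L) ⟩
        count (HitX? j) N L + count (HitY? j) N L + tail (suc j)
          ≤⟨ +-monoˡ-≤ (tail (suc j)) (+-mono-≤ (count-sparse (HitX? j) sparseX N L)
                                                 (count-sparse (HitY? j) sparseY N L)) ⟩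
        suc (L / (p j * p j)) + suc (L / (p j * p j)) + tail (suc j)
          ≤⟨ +-monoˡ-≤ (tail (suc j)) (+-mono-≤ (s≤s (L/p²≤X/[j+1][j+2] j)) (s≤s (L/p²≤X/[j+1][j+2] j))) ⟩
        suc t + suc t + 2 * (X / suc (suc j))
          ≡⟨ regroup t (X / suc (suc j)) ⟩
        2 + 2 * (t + X / suc (suc j))
          ≤⟨ +-monoʳ-≤ 2 (*-monoʳ-≤ 2 (/-telescope X j)) ⟩
        2 + tail j ∎
        where
        open ≤-Reasoning
        t : ℕ
        t = X / (suc j * suc (suc j))
        regroup : ∀ t u → suc t + suc t + 2 * u ≡ 2 + 2 * (t + u)
        regroup = solve-∀
        sparseX : Sparse (p j * p j) (HitX j)
        sparseX m<n (p-prime , p²∣x[m]) (_ , p²∣x[n]) =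
          square-divisors-sparse A (2 * c) p-prime (x-coefficients-coprime p-prime) m<n p²∣x[m] p²∣x[n]
        sparseY : Sparse (p j * p j) (HitY j)
        sparseY m<n (p-prime , p²∣y[m]) (_ , p²∣y[n]) =
          square-divisors-sparse B (2 * e) p-prime (y-coefficients-coprime p-prime) m<n p²∣y[m] p²∣y[n]

      Bad? : Decidable (λ n → ∃ λ j → j < J × Hit j n)
      Bad? = Any? Hit? J

      count-Bad : count Bad? N L < L
      count-Bad = begin-strict
        count Bad? N L   ≤⟨ +-cancelʳ-≤ 2 _ _ bound ⟩
        J * 4            <⟨ m<n+m (J * 4) {4} z<s ⟩
        L                ∎
        where
        open ≤-Reasoning
        regroup : ∀ J → J * 2 + 2 * suc J ≡ J * 4 + 2
        regroup = solve-∀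
        bound : count Bad? N L + 2 ≤ J * 4 + 2
        bound = begin
          count Bad? N L + 2             ≡⟨ cong (λ t → count Bad? N L + 2 * t) (n/n≡1 X) ⟨
          count Bad? N L + 2 * (X / X)   ≤⟨ count-Any Hit? N L 2 tail count-Hit J ⟩
          J * 2 + 2 * (X / 1)            ≡⟨ cong (λ t → J * 2 + 2 * t) (n/1≡n X) ⟩
          J * 2 + 2 * suc J              ≡⟨ regroup J ⟩
          J * 4 + 2                      ∎

      below-J² : ∀ a k → a + K * (N + 4) < R → k ≤ K → ∀ {n} → n ≤ N + L → a + k * n ≤ J * J
      below-J² a k a<R k≤K {n} n≤N+L = begin
        a + k * n                     ≤⟨ +-monoʳ-≤ a (*-mono-≤ k≤K n≤N+L) ⟩
        a + K * (N + L)               ≡⟨ regroup a K N J ⟩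
        a + K * (N + 4) + 4 * K * J   ≤⟨ +-monoˡ-≤ (4 * K * J) (≤-trans (<⇒≤ a<R) (m≤m*n R J)) ⟩
        R * J + 4 * K * J             ≡⟨ *-distribʳ-+ J R (4 * K) ⟨
        J * J                         ∎
        where
        open ≤-Reasoning
        regroup : ∀ a K N J → a + K * (N + suc J * 4) ≡ a + K * (N + 4) + 4 * K * J
        regroup = solve-∀

      x≤J² : ∀ {n} → n ≤ N + L → x n ≤ J * J
      x≤J² = below-J² A (2 * c) (s≤s (+-monoˡ-≤ (K * (N + 4)) (m≤m+n A B))) (m≤m+n (2 * c) (2 * e))

      y≤J² : ∀ {n} → n ≤ N + L → y n ≤ J * J
      y≤J² = below-J² B (2 * e) (s≤s (+-monoˡ-≤ (K * (N + 4)) (m≤n+m B A))) (m≤n+m (2 * e) (2 * c))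

      small-odd-prime : ∀ {q z} → Prime q → q * q ∣ z → ¬ 2 ∣ z → z ≤ J * J → ∃ λ j → j < J × q ≡ p j
      small-odd-prime {q} {z} q-prime q²∣z z-odd z≤J²
        with odd-prime⇒≡3+2* q-prime (λ 2∣q → z-odd (∣-trans 2∣q (m*n∣⇒m∣ q q q²∣z)))
      ... | j , q≡p[j] = j , <-≤-trans j<p[j] (subst (_≤ J) q≡p[j] q≤J) , q≡p[j]
        where
        q≤J : q ≤ J
        q≤J = square-cancel-≤ (≤-trans (∣⇒≤ {{odd⇒nonZero z-odd}} q²∣z) z≤J²)
        j<p[j] : j < p j
        j<p[j] = s≤s (≤-trans (m≤m+n j (j + 0)) (m≤n+m (2 * j) 2))

      squarefree-at : ∀ {n} → n < N + L → ¬ (∃ λ j → j < J × Hit j n) → Squarefreeℕ (x n * y n)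
      squarefree-at {n} n<N+L no-hit = squarefree-by-primes {{xy≢0}} no-prime-square
        where
        xy≢0 : NonZero (x n * y n)
        xy≢0 = m*n≢0 (x n) (y n) {{odd⇒nonZero (x-odd n)}} {{odd⇒nonZero (y-odd n)}}
        no-prime-square : ∀ {q} → Prime q → ¬ q * q ∣ x n * y n
        no-prime-square {q} q-prime q²∣xy =
          no-hit (hit (prime²∣*-split (x n) (y n) q-prime (no-common-prime n q-prime) q²∣xy))
          where
          at : (∃ λ j → j < J × q ≡ p j) → (Prime q × q * q ∣ x n) ⊎ (Prime q × q * q ∣ y n) →
               ∃ λ j → j < J × Hit j n
          at (j , j<J , refl) hit = j , j<J , hit
          hit : q * q ∣ x n ⊎ q * q ∣ y n → ∃ λ j → j < J × Hit j n
          hit (inj₁ q²∣x) =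
            at (small-odd-prime q-prime q²∣x (x-odd n) (x≤J² (<⇒≤ n<N+L))) (inj₁ (q-prime , q²∣x))
          hit (inj₂ q²∣y) =
            at (small-odd-prime q-prime q²∣y (y-odd n) (y≤J² (<⇒≤ n<N+L))) (inj₂ (q-prime , q²∣y))

      squarefree-value : ∃ λ n → N ≤ n × Squarefreeℕ (x n * y n)
      squarefree-value = choose (count<⇒∃¬ Bad? N L count-Bad)
        where
        choose : (∃ λ n → N ≤ n × n < N + L × ¬ (∃ λ j → j < J × Hit j n)) →
                 ∃ λ n → N ≤ n × Squarefreeℕ (x n * y n)
        choose (n , N≤n , n<N+L , no-hit) = n , N≤n , squarefree-at n<N+L no-hit

    squarefree-values : ∀ N → ∃ λ n → N ≤ n × Squarefreeℕ (x n * y n)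
    squarefree-values = Window.squarefree-value

module BasePoint where

  open import Data.Nat
  open import Data.Nat.Properties
  open import Data.Nat.Divisibility
  open import Data.Product using (_×_; _,_)
  open import Data.Sum using (_⊎_; inj₁; inj₂)
  open import Relation.Nullary using (¬_; contradiction)
  open import Relation.Binary.PropositionalEquality
  open import Data.Nat.Tactic.RingSolver using (solve-∀)
  open SquareDivisors using (∤m∣n⇒∤m+n; odd*odd)

  bézout-relation : ∀ P Q x y T → 1 + y * Q ≡ x * P → Q * (2 * y + P * T) + 2 ≡ P * (2 * x + Q * T)
  bézout-relation P Q x y T 1+yQ≡xP = begin
    Q * (2 * y + P * T) + 2       ≡⟨ expand₁ P Q y T ⟩
    2 * (1 + y * Q) + P * Q * T   ≡⟨ cong (λ t → 2 * t + P * Q * T) 1+yQ≡xP ⟩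
    2 * (x * P) + P * Q * T       ≡⟨ expand₂ P Q x T ⟩
    P * (2 * x + Q * T)           ∎
    where
    open ≡-Reasoning
    expand₁ : ∀ P Q y T → Q * (2 * y + P * T) + 2 ≡ 2 * (1 + y * Q) + P * Q * T
    expand₁ = solve-∀
    expand₂ : ∀ P Q x T → 2 * (x * P) + P * Q * T ≡ P * (2 * x + Q * T)
    expand₂ = solve-∀

  -- From a Bézout identity xP − yQ = ±1: then P D₂ − Q D₁ = 2(xP − yQ), and the odd factor T
  -- exceeds 2x and 2y, which is what the order conditions need.
  module BaseCandidate (P Q x y : ℕ) where

    T D₁ D₂ : ℕ
    T = 1 + 2 * (x + y)
    D₁ = 2 * y + P * T
    D₂ = 2 * x + Q * T

    T-odd : ¬ 2 ∣ T
    T-odd = ∤m∣n⇒∤m+n (λ 2∣1 → contradiction (∣1⇒≡1 2∣1) λ ()) (m∣m*n (x + y))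

    D₁-odd : ¬ 2 ∣ P → ¬ 2 ∣ D₁
    D₁-odd P-odd 2∣D₁ = ∤m∣n⇒∤m+n (odd*odd P-odd T-odd) (m∣m*n y) (subst (2 ∣_) (+-comm (2 * y) (P * T)) 2∣D₁)

    D₂-odd : ¬ 2 ∣ Q → ¬ 2 ∣ D₂
    D₂-odd Q-odd 2∣D₂ = ∤m∣n⇒∤m+n (odd*odd Q-odd T-odd) (m∣m*n x) (subst (2 ∣_) (+-comm (2 * x) (Q * T)) 2∣D₂)

    relation : 1 + y * Q ≡ x * P ⊎ 1 + x * P ≡ y * Q → Q * D₁ + 2 ≡ P * D₂ ⊎ P * D₂ + 2 ≡ Q * D₁
    relation (inj₁ 1+yQ≡xP) = inj₁ (bézout-relation P Q x y T 1+yQ≡xP)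
    relation (inj₂ 1+xP≡yQ) = inj₂ (bézout-relation Q P y x T 1+xP≡yQ)

    order : P < Q → Q < 3 * P → 0 < D₁ × D₁ < D₂ × D₂ ≤ 3 * D₁
    order P<Q Q<3P = 0<D₁ , D₁<D₂ , D₂≤3D₁
      where
      open ≤-Reasoning
      2x<T : 2 * x < T
      2x<T = s≤s (*-monoʳ-≤ 2 (m≤m+n x y))
      2y<T : 2 * y < T
      2y<T = s≤s (*-monoʳ-≤ 2 (m≤n+m y x))
      0<P : 0 < P
      0<P = n≢0⇒n>0 λ { refl → contradiction Q<3P λ () }
      0<D₁ : 0 < D₁
      0<D₁ = ≤-trans (≤-trans 0<P (m≤m*n P T)) (m≤n+m (P * T) (2 * y))
      D₁<D₂ : D₁ < D₂
      D₁<D₂ = begin-strict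
        2 * y + P * T   <⟨ +-monoˡ-< (P * T) 2y<T ⟩
        suc P * T       ≤⟨ *-monoˡ-≤ T P<Q ⟩
        Q * T           ≤⟨ m≤n+m (Q * T) (2 * x) ⟩
        2 * x + Q * T   ∎
      D₂≤3D₁ : D₂ ≤ 3 * D₁
      D₂≤3D₁ = begin
        2 * x + Q * T         ≤⟨ +-monoˡ-≤ (Q * T) (<⇒≤ 2x<T) ⟩
        suc Q * T             ≤⟨ *-monoˡ-≤ T Q<3P ⟩
        3 * P * T             ≡⟨ *-assoc 3 P T ⟩
        3 * (P * T)           ≤⟨ *-monoʳ-≤ 3 (m≤n+m (P * T) (2 * y)) ⟩
        3 * (2 * y + P * T)   ∎

module Admissibility where

  open import Defs
  open import Data.Nat as ℕ using (ℕ; suc; s≤s; z≤n)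
  import Data.Nat.Properties as ℕ
  import Data.Nat.Divisibility as ℕ
  open import Data.Nat.Coprimality using (Coprime; coprime-Bézout)
  open import Data.Nat.GCD using (module Bézout)
  open import Data.Integer using (ℤ; +_; -[1+_]; _+_; _-_; _*_; -_; _<_; _≤_; ∣_∣; +<+; +≤+; -<-)
  open import Data.Integer.Properties
  open import Data.Integer.Divisibility.Signed as Signed using (divides; ∣ᵤ⇒∣; ∣⇒∣ᵤ) renaming (_∣_ to _∣ₛ_)
  open import Data.Integer.Tactic.RingSolver using (solve-∀)
  open import Data.Product using (∃; ∃₂; _×_; _,_)
  open import Data.Sum using (_⊎_; inj₁; inj₂)
  open import Function.Bundles using (_⇔_; mk⇔; Equivalence)
  open import Relation.Nullary using (¬_)
  open import Relation.Nullary.Decidable using (from-no)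
  open import Relation.Binary.PropositionalEquality
  open SquareDivisors using (Squarefreeℕ; odd*odd; coprime-squares)
  open SquarefreeValues using (squarefree-values)
  open BasePoint using (module BaseCandidate)

  _≡±2 : ℤ → Set
  r ≡±2 = r ≡ + 2 ⊎ r ≡ - + 2

  odd⇒≡1+2* : ∀ {z} → Odd z → ∃ λ w → z ≡ + 1 + + 2 * w
  odd⇒≡1+2* {+ m} m-odd with SquareDivisors.odd⇒≡1+2* m-odd
  ... | w , refl = + w , cong (λ t → + 1 + t) (pos-* 2 w)
  odd⇒≡1+2* { -[1+ m ]} 1+m-odd with SquareDivisors.odd⇒≡1+2* 1+m-odd
  ... | w , 1+m≡1+2w = - + 1 - + w , (begin
    - + suc m                   ≡⟨ cong (λ t → - + t) 1+m≡1+2w ⟩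
    - + (1 ℕ.+ 2 ℕ.* w)         ≡⟨ cong (λ t → - (+ 1 + t)) (pos-* 2 w) ⟩
    - (+ 1 + + 2 * + w)         ≡⟨ negate (+ w) ⟩
    + 1 + + 2 * (- + 1 - + w)   ∎)
    where
    open ≡-Reasoning
    negate : ∀ w → - (+ 1 + + 2 * w) ≡ + 1 + + 2 * (- + 1 - w)
    negate = solve-∀

  odd+even : ∀ {m e} → Odd m → + 2 ∣ₛ e → Odd (m + e)
  odd+even {m} {e} m-odd 2∣e 2∣m+e = m-odd (∣⇒∣ᵤ {+ 2} {m} (Signed.∣m+n∣n⇒∣m (∣ᵤ⇒∣ {+ 2} {m + e} 2∣m+e) 2∣e))

  ≡3mod4⇒odd : ∀ {m n} → ≡3mod4 (m * n) → Odd m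
  ≡3mod4⇒odd {m} {n} 4∣mn-3 2∣m = from-no (2 ℕ.∣? 3) (∣⇒∣ᵤ (subst (+ 2 ∣ₛ_) (cancel (m * n)) 2∣mn-[mn-3]))
    where
    cancel : ∀ z → z - (z - + 3) ≡ + 3
    cancel = solve-∀
    2∣mn-[mn-3] : + 2 ∣ₛ m * n - (m * n - + 3)
    2∣mn-[mn-3] = Signed.∣m∣n⇒∣m-n (Signed.∣m⇒∣m*n n (∣ᵤ⇒∣ {+ 2} {m} 2∣m))
                    (Signed.∣-trans {+ 2} {+ 4} (divides (+ 2) refl) (∣ᵤ⇒∣ {+ 4} {m * n - + 3} 4∣mn-3))

  odd-relation⇒≡3mod4 : ∀ {d₁ d₂ k l} → Odd k → Odd l → Odd d₁ → Odd d₂ →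
                        (k * k * d₂ - l * l * d₁) ≡±2 → ≡3mod4 (d₁ * d₂)
  odd-relation⇒≡3mod4 {d₁} {d₂} {k} {l} k-odd l-odd d₁-odd d₂-odd rel
    with odd⇒≡1+2* {k} k-odd | odd⇒≡1+2* {l} l-odd | odd⇒≡1+2* {d₁} d₁-odd | odd⇒≡1+2* {d₂} d₂-odd
  ... | κ , refl | λ′ , refl | u , refl | v , refl =
    ∣⇒∣ᵤ (subst (+ 4 ∣ₛ_) (sym (identity κ λ′ u v))
           (Signed.∣m∣n⇒∣m+n (Signed.∣m⇒∣m*n (quotient κ λ′ u v) (Signed.∣-refl {+ 4})) (4∣r-2 rel)))
    where
    quotient : ℤ → ℤ → ℤ → ℤ → ℤ
    quotient κ λ′ u v = u * v + u - ((κ * κ + κ) * (+ 1 + + 2 * v) - (λ′ * λ′ + λ′) * (+ 1 + + 2 * u))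
    -- Odd squares are 1 mod 4, so r = k²d₂ − l²d₁ ≡ 2(v − u) and (1 + 2u)(1 + 2v) − 3 = 4q + (r − 2).
    identity : ∀ κ λ′ u v →
      (+ 1 + + 2 * u) * (+ 1 + + 2 * v) - + 3 ≡
      + 4 * (u * v + u - ((κ * κ + κ) * (+ 1 + + 2 * v) - (λ′ * λ′ + λ′) * (+ 1 + + 2 * u)))
        + ((+ 1 + + 2 * κ) * (+ 1 + + 2 * κ) * (+ 1 + + 2 * v)
           - (+ 1 + + 2 * λ′) * (+ 1 + + 2 * λ′) * (+ 1 + + 2 * u) - + 2)
    identity = solve-∀
    4∣r-2 : ∀ {r} → r ≡±2 → + 4 ∣ₛ r - + 2
    4∣r-2 (inj₁ refl) = divides (+ 0) refl
    4∣r-2 (inj₂ refl) = divides (- + 1) refl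

  0≤i*i : ∀ i → + 0 ≤ i * i
  0≤i*i (+ m) = subst (+ 0 ≤_) (pos-* m m) (+≤+ z≤n)
  0≤i*i -[1+ m ] = +≤+ z≤n

  -- The conditions of Good other than squarefreeness, with d₁d₂ ≡ 3 (mod 4) weakened to the oddness of d₁ and
  -- d₂ (odd-relation⇒≡3mod4 recovers it).
  record Admissible (d₁ d₂ k l : ℤ) : Set where
    constructor admissible
    field
      d₁-pos   : + 0 < d₁
      d₁<d₂    : d₁ < d₂
      d₂≤3d₁   : d₂ ≤ + 3 * d₁
      d₁-odd   : Odd d₁
      d₂-odd   : Odd d₂
      relation : (k * k * d₂ - l * l * d₁) ≡±2

  Admissible-shift : ∀ {d₁ d₂ k l} → k * k ≤ l * l → l * l ≤ + 3 * (k * k) → Admissible d₁ d₂ k l →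
                     ∀ n → Admissible (d₁ + + 2 * (k * k) * + n) (d₂ + + 2 * (l * l) * + n) k l
  Admissible-shift {d₁} {d₂} {k} {l} k²≤l² l²≤3k² (admissible 0<d₁ d₁<d₂ d₂≤3d₁ d₁-odd d₂-odd rel) n =
    admissible (+-mono-<-≤ 0<d₁ (step-mono (0≤i*i k)))
               (+-mono-<-≤ d₁<d₂ (step-mono k²≤l²))
               d₂′≤3d₁′
               (odd+even {d₁} d₁-odd (step-even (k * k)))
               (odd+even {d₂} d₂-odd (step-even (l * l)))
               (subst _≡±2 (sym (invariant k l d₁ d₂ (+ n))) rel)
    where
    step : ℤ → ℤ
    step s = + 2 * s * + n
    step-mono : ∀ {s t} → s ≤ t → step s ≤ step t
    step-mono s≤t = *-monoʳ-≤-nonNeg (+ n) (*-monoˡ-≤-nonNeg (+ 2) s≤t)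
    step-even : ∀ s → + 2 ∣ₛ step s
    step-even s = Signed.∣m⇒∣m*n (+ n) (Signed.∣m⇒∣m*n s (Signed.∣-refl {+ 2}))
    distribute : ∀ d s n → + 3 * d + + 2 * (+ 3 * s) * n ≡ + 3 * (d + + 2 * s * n)
    distribute = solve-∀
    d₂′≤3d₁′ : d₂ + step (l * l) ≤ + 3 * (d₁ + step (k * k))
    d₂′≤3d₁′ = begin
      d₂ + step (l * l)                 ≤⟨ +-mono-≤ d₂≤3d₁ (step-mono l²≤3k²) ⟩
      + 3 * d₁ + step (+ 3 * (k * k))   ≡⟨ distribute d₁ (k * k) (+ n) ⟩
      + 3 * (d₁ + step (k * k))         ∎
      where open ≤-Reasoning
    invariant : ∀ k l d₁ d₂ n →
      k * k * (d₂ + + 2 * (l * l) * n) - l * l * (d₁ + + 2 * (k * k) * n) ≡ k * k * d₂ - l * l * d₁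
    invariant = solve-∀

  Good⇒Admissible : ∀ {d₁ d₂ k l} → Good d₁ d₂ k l → Admissible d₁ d₂ k l
  Good⇒Admissible {d₁} {d₂} (0<d₁ , _ , _ , d₁d₂≡3 , d₁<d₂ , d₂≤3d₁ , rel) =
    admissible 0<d₁ d₁<d₂ d₂≤3d₁ (≡3mod4⇒odd {d₁} {d₂} d₁d₂≡3)
               (≡3mod4⇒odd {d₂} {d₁} (subst ≡3mod4 (*-comm d₁ d₂) d₁d₂≡3)) rel

  Admissible⇒Good : ∀ {d₁ d₂ k l} → Odd k → Odd l → Admissible d₁ d₂ k l → Squarefree (d₁ * d₂) →
                    Good d₁ d₂ k l
  Admissible⇒Good {d₁} {d₂} {k} {l} k-odd l-odd (admissible 0<d₁ d₁<d₂ d₂≤3d₁ d₁-odd d₂-odd rel) squarefree =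
    0<d₁ , <-trans 0<d₁ d₁<d₂ , squarefree ,
    odd-relation⇒≡3mod4 {d₁} {d₂} {k} {l} k-odd l-odd d₁-odd d₂-odd rel , d₁<d₂ , d₂≤3d₁ , rel

  pos-*-* : ∀ a b c → + a * + b * + c ≡ + (a ℕ.* b ℕ.* c)
  pos-*-* a b c = trans (cong (_* + c) (sym (pos-* a b))) (sym (pos-* (a ℕ.* b) c))

  pos-*-*ʳ : ∀ a b c → + a * (+ b * + c) ≡ + (a ℕ.* (b ℕ.* c))
  pos-*-*ʳ a b c = trans (cong (+ a *_) (sym (pos-* b c))) (sym (pos-* a (b ℕ.* c)))

  pos-shift : ∀ X a n → + X + + 2 * (+ a * + a) * + n ≡ + (X ℕ.+ 2 ℕ.* (a ℕ.* a) ℕ.* n)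
  pos-shift X a n = trans (cong (λ t → + X + + 2 * t * + n) (sym (pos-* a a)))
                          (cong (λ t → + X + t) (pos-*-* 2 (a ℕ.* a) n))

  +-diff≡±2⇔ : ∀ m n → (+ m - + n) ≡±2 ⇔ (n ℕ.+ 2 ≡ m ⊎ m ℕ.+ 2 ≡ n)
  +-diff≡±2⇔ m n = mk⇔ to from
    where
    to : (+ m - + n) ≡±2 → n ℕ.+ 2 ≡ m ⊎ m ℕ.+ 2 ≡ n
    to (inj₁ m-n≡2) = inj₁ (+-injective (trans (cong (λ t → + n + t) (sym m-n≡2)) (cancel (+ n) (+ m))))
      where
      cancel : ∀ i j → i + (j - i) ≡ j
      cancel = solve-∀
    to (inj₂ m-n≡-2) = inj₂ (+-injective (trans (cong (λ t → + m - t) (sym m-n≡-2)) (cancel (+ m) (+ n))))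
      where
      cancel : ∀ i j → i - (i - j) ≡ j
      cancel = solve-∀
    from : n ℕ.+ 2 ≡ m ⊎ m ℕ.+ 2 ≡ n → (+ m - + n) ≡±2
    from (inj₁ refl) = inj₁ (cancel (+ n) (+ 2))
      where
      cancel : ∀ i j → i + j - i ≡ j
      cancel = solve-∀
    from (inj₂ refl) = inj₂ (cancel (+ m) (+ 2))
      where
      cancel : ∀ i j → i - (i + j) ≡ - j
      cancel = solve-∀

  squarefree-pos-* : ∀ u v → Squarefreeℕ (u ℕ.* v) → Squarefree (+ u * + v)
  squarefree-pos-* u v squarefree m m²∣uv =
    squarefree ∣ m ∣ (subst₂ ℕ._∣_ (abs-* m m) (abs-* (+ u) (+ v)) m²∣uv)

  module OddPair {a b : ℕ} (a-odd : Odd (+ a)) (b-odd : Odd (+ b))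
                 (a<b : a ℕ.< b) (b²<3a² : b ℕ.* b ℕ.< 3 ℕ.* (a ℕ.* a)) where

    a²<b² : a ℕ.* a ℕ.< b ℕ.* b
    a²<b² = ℕ.*-mono-< a<b a<b

    k²≤l² : + a * + a ≤ + b * + b
    k²≤l² = subst₂ _≤_ (pos-* a a) (pos-* b b) (+≤+ (ℕ.<⇒≤ a²<b²))

    l²≤3k² : + b * + b ≤ + 3 * (+ a * + a)
    l²≤3k² = subst₂ _≤_ (pos-* b b) (sym (pos-*-*ʳ 3 a a)) (+≤+ (ℕ.<⇒≤ b²<3a²))

    relation-ℕ : ∀ {X Y} → (+ a * + a * + Y - + b * + b * + X) ≡±2 →
                 b ℕ.* b ℕ.* X ℕ.+ 2 ≡ a ℕ.* a ℕ.* Y ⊎ a ℕ.* a ℕ.* Y ℕ.+ 2 ≡ b ℕ.* b ℕ.* X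
    relation-ℕ {X} {Y} rel =
      Equivalence.to (+-diff≡±2⇔ _ _) (subst₂ (λ u v → (u - v) ≡±2) (pos-*-* a a Y) (pos-*-* b b X) rel)

    relation-ℤ : ∀ {X Y} → b ℕ.* b ℕ.* X ℕ.+ 2 ≡ a ℕ.* a ℕ.* Y ⊎ a ℕ.* a ℕ.* Y ℕ.+ 2 ≡ b ℕ.* b ℕ.* X →
                 (+ a * + a * + Y - + b * + b * + X) ≡±2
    relation-ℤ {X} {Y} rel =
      subst₂ (λ u v → (u - v) ≡±2) (sym (pos-*-* a a Y)) (sym (pos-*-* b b X))
             (Equivalence.from (+-diff≡±2⇔ _ _) rel)

    good-shift : ∀ {d₁ d₂} → Admissible d₁ d₂ (+ a) (+ b) → ∀ N → ∃ λ n → N ℕ.≤ ∣ n ∣ ×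
                 Good (d₁ + + 2 * (+ a * + a) * n) (d₂ + + 2 * (+ b * + b) * n) (+ a) (+ b)
    good-shift { -[1+ _ ]} (admissible () _ _ _ _ _)
    good-shift {+ X} { -[1+ _ ]} (admissible _ () _ _ _ _)
    good-shift {+ X} {+ Y} XY-admissible@(admissible _ _ _ X-odd Y-odd rel) N =
      let n , N≤n , squarefree = squarefree-values X Y (a ℕ.* a) (b ℕ.* b) X-odd Y-odd (relation-ℕ rel) N
      in + n , N≤n ,
         Admissible⇒Good a-odd b-odd (Admissible-shift k²≤l² l²≤3k² XY-admissible n)
           (subst Squarefree (cong₂ _*_ (sym (pos-shift X a n)) (sym (pos-shift Y b n)))
                  (squarefree-pos-* (X ℕ.+ 2 ℕ.* (a ℕ.* a) ℕ.* n) (Y ℕ.+ 2 ℕ.* (b ℕ.* b) ℕ.* n) squarefree))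

    admissible-base : ∀ x y → let open BaseCandidate (a ℕ.* a) (b ℕ.* b) x y in
                      1 ℕ.+ y ℕ.* (b ℕ.* b) ≡ x ℕ.* (a ℕ.* a) ⊎ 1 ℕ.+ x ℕ.* (a ℕ.* a) ≡ y ℕ.* (b ℕ.* b) →
                      Admissible (+ D₁) (+ D₂) (+ a) (+ b)
    admissible-base x y bézout =
      let 0<D₁ , D₁<D₂ , D₂≤3D₁ = order a²<b² b²<3a²
      in admissible (+<+ 0<D₁) (+<+ D₁<D₂) (subst (+ D₂ ≤_) (pos-* 3 D₁) (+≤+ D₂≤3D₁))
                    (D₁-odd (odd*odd a-odd a-odd)) (D₂-odd (odd*odd b-odd b-odd))
                    (relation-ℤ (relation bézout))
      where open BaseCandidate (a ℕ.* a) (b ℕ.* b) x y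

    base-point : Coprime a b → ∃₂ λ d₁ d₂ → Admissible d₁ d₂ (+ a) (+ b)
    base-point coprime with coprime-Bézout (coprime-squares coprime)
    ... | Bézout.+- x y 1+yQ≡xP = _ , _ , admissible-base x y (inj₁ 1+yQ≡xP)
    ... | Bézout.-+ x y 1+xP≡yQ = _ , _ , admissible-base x y (inj₂ 1+xP≡yQ)

    existence : Coprime a b → ∃₂ λ d₁ d₂ → Good d₁ d₂ (+ a) (+ b)
    existence coprime =
      let _ , _ , base-admissible = base-point coprime
          _ , _ , good = good-shift base-admissible 0
      in _ , _ , good

  LtSqrt3Times⇒ℕ : ∀ {a b} → LtSqrt3Times (+ b) (+ a) → b ℕ.* b ℕ.< 3 ℕ.* (a ℕ.* a)
  LtSqrt3Times⇒ℕ (inj₁ (_ , inj₁ (+<+ ())))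
  LtSqrt3Times⇒ℕ {a} {b} (inj₁ (_ , inj₂ l²<3k²)) =
    drop‿+<+ (subst₂ _<_ (sym (pos-* b b)) (pos-*-*ʳ 3 a a) l²<3k²)
  LtSqrt3Times⇒ℕ (inj₂ (+<+ () , _))

  ¬LtSqrt3Times-neg : ∀ {a l} → -[1+ a ] < l → ¬ LtSqrt3Times l -[1+ a ]
  ¬LtSqrt3Times-neg _ (inj₁ (() , _))
  ¬LtSqrt3Times-neg _ (inj₂ (_ , +<+ () , _))
  ¬LtSqrt3Times-neg {a} (-<- {n = b} b<a) (inj₂ (_ , _ , 3k²<l²)) =
    ℕ.<⇒≱ (drop‿+<+ 3k²<l²) (ℕ.≤-trans (ℕ.*-mono-≤ 1+b≤1+a 1+b≤1+a) (ℕ.m≤n*m (suc a ℕ.* suc a) 3))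
    where
    1+b≤1+a : suc b ℕ.≤ suc a
    1+b≤1+a = ℕ.<⇒≤ (s≤s b<a)

open Admissibility
open import Data.Empty using (⊥-elim)
open import Data.Integer using (-[1+_]; +<+)
open import Data.Integer.Properties using (+-injective)
open import Data.Nat.Coprimality using (gcd≡1⇒coprime)
open import Data.Product using (_,_)

open import Defs
open import Data.Nat using (ℕ; _≤_)
open import Data.Integer using (ℤ; +_; _+_; _*_; _<_; ∣_∣)
open import Data.Integer.GCD using (gcd)
open import Data.Product using (_×_; ∃; ∃₂)
open import Relation.Binary.PropositionalEquality using (_≡_)

theorem5p5 : (k l : ℤ) → Odd k → Odd l → gcd k l ≡ + 1 → k < l → LtSqrt3Times l k
    → (∃₂ λ d₁ d₂ → Good d₁ d₂ k l)
      × (∀ (d₁′ d₂′ : ℤ) → Good d₁′ d₂′ k l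
           → ∀ (N : ℕ) → ∃ λ (n : ℤ) → (N ≤ ∣ n ∣)
               × Good (d₁′ + + 2 * (k * k) * n) (d₂′ + + 2 * (l * l) * n) k l)
theorem5p5 (+ a) (+ b) a-odd b-odd gcd≡1 (+<+ a<b) l<√3k =
  existence (gcd≡1⇒coprime (+-injective gcd≡1)) ,
  λ d₁′ d₂′ good → good-shift {d₁′} {d₂′} (Good⇒Admissible good)
  where open OddPair a-odd b-odd a<b (LtSqrt3Times⇒ℕ l<√3k)
theorem5p5 (+ _) -[1+ _ ] _ _ _ () _
theorem5p5 -[1+ _ ] _ _ _ _ k<l l<√3k = ⊥-elim (¬LtSqrt3Times-neg k<l l<√3k)
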